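{- There exist a topological space $X$ and a family $B$ of regular closed subsets of $X$ containing $\emptyset$ and $X$ and closed under $\cup$ such that the structure $(B,\subseteq,\emptyset,X,\cup,C)$, where $aCb$ iff $a\cap b\neq\emptyset$, is a contact join-semilattice but not a distributive contact join-semilattice.
   Context: A subset of a topological space is regular closed if it equals the closure of its interior. All structures are of the form $(B,\leq,0,1,+,C)$. Axioms (for all elements): (1) $x\leq x$; (2) $x\leq y\wedge y\leq x\rightarrow x=y$; (3) $x\leq y\wedge y\leq z\rightarrow x\leq z$; (4) $x+y=y+x$; (5) $x\leq x+y$; (6) $x\leq z\wedge y\leq z\rightarrow x+y\leq z$; (7) $0\leq x$; (8) $x\leq 1$; (9) $xCy\rightarrow x\neq 0$; (10) $xCy\rightarrow yCx$; (11) $xC(y+z)\rightarrow xCy$ or $xCz$; (12) $xCy\wedge y\leq y'\rightarrow xCy'$; (13) $x\neq 0\rightarrow xCx$; (ad) if $x\leq a+b$ then there are $a'\leq a$, $b'\leq b$ with $x=a'+b'$; and for all integers $m,i,n\geq1$: $A^1_{m,i}$: if $xCy$, and $x\leq s_j^1+\dots+s_j^i$ and $y\leq t_j^1+\dots+t_j^i$ for every $j=1,\dots,m$, then there are $l_1,\dots,l_m,k_1,\dots,k_m\in\{1,\dots,i\}$ with $s_j^{l_j}Cs_u^{l_u}$ and $t_j^{k_j}Ct_u^{k_u}$ for all $1\leq j\leq u\leq m$, and $s_j^{l_j}Ct_u^{k_u}$ for all $j,u$; $A_{n,i}$: if $t\not\leq u$ and $t\leq x_k^1+\dots+x_k^i$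 for every $k=1,\dots,n$, then there are $j_1,\dots,j_n\in\{1,\dots,i\}$ with $x_k^{j_k}\not\leq u$ for all $k$ and $x_k^{j_k}Cx_l^{j_l}$ for all $k,l$. A contact join-semilattice (CJS) satisfies (1)–(10) and all $A^1_{m,i}$, $A_{n,i}$. A distributive contact join-semilattice (DCJS) satisfies (1)–(13) and (ad). -}

module Defs where

open import Level using (Level; _⊔_; 0ℓ) renaming (suc to lsuc)
open import Data.Nat using (ℕ; zero; suc)
open import Data.Fin using (Fin; zero; suc) renaming (_≤_ to _≤F_)
open import Data.Product using (Σ; Σ-syntax; ∃; _×_; _,_; proj₁)
open import Data.Sum using (_⊎_)
open import Relation.Nullary using (¬_)
open import Relation.Unary using (Pred; _⊆_; _≐_; _∩_; _∪_; ∅; U; ⋃; Satisfiable)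

record Topology (X : Set) : Set₁ where
  field
    IsOpen : Pred (Pred X 0ℓ) 0ℓ
    open-U : IsOpen U
    open-∩ : ∀ {P Q} → IsOpen P → IsOpen Q → IsOpen (P ∩ Q)
    open-⋃ : (I : Set) (F : I → Pred X 0ℓ) → (∀ i → IsOpen (F i)) → IsOpen (⋃ I F)

module _ {X : Set} (τ : Topology X) where
  open Topology τ

  interior : Pred X 0ℓ → Pred X (lsuc 0ℓ)
  interior A x = Σ[ V ∈ Pred X 0ℓ ] (IsOpen V × V x × V ⊆ A)

  closure : ∀ {ℓ} → Pred X ℓ → Pred X (lsuc 0ℓ ⊔ ℓ)
  closure A x = (V : Pred X 0ℓ) → IsOpen V → V x → Satisfiable (V ∩ A)

  RegularClosed : Pred X 0ℓ → Set₁
  RegularClosed A = A ≐ closure (interior A)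

-- Structures (B, ≤, 0, 1, +, C); "=" of the paper is the relation _≈_

record ContactStructure (a ℓ : Level) : Set (lsuc (a ⊔ ℓ)) where
  infix 4 _≈_ _≤_ _C_
  infixl 6 _+_
  field
    Carrier : Set a
    _≈_ : Carrier → Carrier → Set ℓ
    _≤_ : Carrier → Carrier → Set ℓ
    𝟘 𝟙 : Carrier
    _+_ : Carrier → Carrier → Carrier
    _C_ : Carrier → Carrier → Set ℓ

  -- s¹ + ... + sⁱ  (i ≥ 1 elements, indexed by Fin (suc k))
  ⨆ : ∀ {k} → (Fin (suc k) → Carrier) → Carrier
  ⨆ {zero}  s = s zero
  ⨆ {suc k} s = s zero + ⨆ {k} (λ l → s (suc l))

  -- Axiom A¹_{m,i}  (here m = suc m', i = suc i')
  A¹ : ℕ → ℕ → Set (a ⊔ ℓ)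
  A¹ m' i' =
    ∀ (x y : Carrier) (s t : Fin (suc m') → Fin (suc i') → Carrier) →
    x C y → (∀ j → x ≤ ⨆ (s j)) → (∀ j → y ≤ ⨆ (t j)) →
    Σ[ l ∈ (Fin (suc m') → Fin (suc i')) ] Σ[ k ∈ (Fin (suc m') → Fin (suc i')) ]
      ((∀ j u → j ≤F u → s j (l j) C s u (l u)) ×
       (∀ j u → j ≤F u → t j (k j) C t u (k u)) ×
       (∀ j u → s j (l j) C t u (k u)))

  -- Axiom A_{n,i}  (here n = suc n', i = suc i')
  Aₙ : ℕ → ℕ → Set (a ⊔ ℓ)
  Aₙ n' i' =
    ∀ (t u : Carrier) (x : Fin (suc n') → Fin (suc i') → Carrier) →
    ¬ (t ≤ u) → (∀ k → t ≤ ⨆ (x k)) →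
    Σ[ j ∈ (Fin (suc n') → Fin (suc i')) ]
      ((∀ k → ¬ (x k (j k) ≤ u)) × (∀ k l → x k (j k) C x l (j l)))

module _ {a ℓ : Level} (S : ContactStructure a ℓ) where
  open ContactStructure S

  record IsCJS : Set (a ⊔ ℓ) where
    field
      ax1  : ∀ x → x ≤ x
      ax2  : ∀ x y → x ≤ y → y ≤ x → x ≈ y
      ax3  : ∀ x y z → x ≤ y → y ≤ z → x ≤ z
      ax4  : ∀ x y → (x + y) ≈ (y + x)
      ax5  : ∀ x y → x ≤ x + y
      ax6  : ∀ x y z → x ≤ z → y ≤ z → x + y ≤ z
      ax7  : ∀ x → 𝟘 ≤ x
      ax8  : ∀ x → x ≤ 𝟙
      ax9  : ∀ x y → x C y → ¬ (x ≈ 𝟘)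
      ax10 : ∀ x y → x C y → y C x
      axA¹ : ∀ m' i' → A¹ m' i'
      axA  : ∀ n' i' → Aₙ n' i'

  record IsDCJS : Set (a ⊔ ℓ) where
    field
      ax1  : ∀ x → x ≤ x
      ax2  : ∀ x y → x ≤ y → y ≤ x → x ≈ y
      ax3  : ∀ x y z → x ≤ y → y ≤ z → x ≤ z
      ax4  : ∀ x y → (x + y) ≈ (y + x)
      ax5  : ∀ x y → x ≤ x + y
      ax6  : ∀ x y z → x ≤ z → y ≤ z → x + y ≤ z
      ax7  : ∀ x → 𝟘 ≤ x
      ax8  : ∀ x → x ≤ 𝟙
      ax9  : ∀ x y → x C y → ¬ (x ≈ 𝟘)
      ax10 : ∀ x y → x C y → y C x
      ax11 : ∀ x y z → x C (y + z) → (x C y) ⊎ (x C z)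
      ax12 : ∀ x y y' → x C y → y ≤ y' → x C y'
      ax13 : ∀ x → ¬ (x ≈ 𝟘) → x C x
      axad : ∀ x a b → x ≤ a + b →
               Σ[ a' ∈ Carrier ] Σ[ b' ∈ Carrier ] (a' ≤ a × b' ≤ b × x ≈ a' + b')

setStructure : {X : Set} (B : Pred (Pred X 0ℓ) (lsuc 0ℓ)) →
               B ∅ → B U → (∀ {P Q} → B P → B Q → B (P ∪ Q)) →
               ContactStructure (lsuc 0ℓ) 0ℓ
setStructure {X} B b∅ bU b∪ = record
  { Carrier = Σ (Pred X 0ℓ) B
  ; _≈_ = λ p q → proj₁ p ≐ proj₁ q
  ; _≤_ = λ p q → proj₁ p ⊆ proj₁ q
  ; 𝟘 = ∅ , b∅
  ; 𝟙 = U , bU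
  ; _+_ = λ { (P , bP) (Q , bQ) → (P ∪ Q) , b∪ bP bQ }
  ; _C_ = λ p q → Satisfiable (proj₁ p ∩ proj₁ q)
  }

-- Take the three-point discrete space and let B consist of the subsets that are not singletons.
-- Every subset of a discrete space is regular closed, and a union of non-singletons is not a
-- singleton. Since contact is overlap, the axioms A¹ and A hold pointwise: a common point of x and y
-- (of t and not u) lies in some summand of each given join, and the chosen summands all meet there.
-- Distributivity (ad) fails: {0,2} ⊆ {0,1} ∪ {1,2}, but a part a' ⊆ {0,1} containing 0 cannot be
-- a singleton, so it contains 1 ∉ {0,2}.
module Submission where

open import Defs
open import Level using (0ℓ; Lift; lift) renaming (suc to lsuc)
open import Data.Empty using (⊥-elim)
open import Data.Fin using (Fin; zero; suc; _≟_; #_)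
open import Data.Fin.Properties using (¬∀⟶∃¬)
open import Data.Nat using (zero; suc)
open import Data.Product using (Σ; Σ-syntax; ∃; _×_; _,_; proj₁; proj₂)
open import Data.Sum using (inj₁; inj₂; [_,_])
open import Data.Unit using (⊤; tt)
open import Relation.Binary.PropositionalEquality using (_≡_; _≢_; refl)
open import Relation.Nullary using (¬_; Dec; yes; no; ¬?; _→-dec_)
open import Relation.Unary
  using (Pred; Decidable; Satisfiable; ∅; U; _∪_; _∩_; _⊆_; ∁; ｛_｝)
open import Relation.Unary.Properties using (∅?; U?; _∪?_)

discrete : (X : Set) → Topology X
discrete X = record
  { IsOpen = λ _ → ⊤ ; open-U = tt ; open-∩ = λ _ _ → tt ; open-⋃ = λ _ _ _ → tt }

regularClosed-discrete : {X : Set} (A : Pred X 0ℓ) → RegularClosed (discrete X) A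
regularClosed-discrete {X} A = A⊆clA , clA⊆A
  where
  A⊆clA : A ⊆ closure (discrete X) (interior (discrete X) A)
  A⊆clA {x} Ax _ _ Vx = x , Vx , A , tt , Ax , λ Ay → Ay

  clA⊆A : closure (discrete X) (interior (discrete X) A) ⊆ A
  clA⊆A {x} x∈clA with x∈clA (x ≡_) tt refl
  ... | _ , refl , _ , _ , Vx , V⊆A = V⊆A Vx

module _ {X : Set} (B : Pred (Pred X 0ℓ) (lsuc 0ℓ))
         (b∅ : B ∅) (bU : B U) (b∪ : ∀ {P Q} → B P → B Q → B (P ∪ Q)) where

  open ContactStructure (setStructure B b∅ bU b∪)

  ⨆-summand : ∀ {k} (s : Fin (suc k) → Carrier) {p} →
              proj₁ (⨆ s) p → ∃ λ l → proj₁ (s l) p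
  ⨆-summand {zero}  s sp        = zero , sp
  ⨆-summand {suc k} s (inj₁ sp) = zero , sp
  ⨆-summand {suc k} s (inj₂ sp) with ⨆-summand (λ l → s (suc l)) sp
  ... | l , slp = suc l , slp

  setStructure-isCJS : (∀ {P Q} → B P → B Q → ¬ (P ⊆ Q) → Satisfiable (P ∩ ∁ Q)) →
                       IsCJS (setStructure B b∅ bU b∪)
  setStructure-isCJS separate = record
    { ax1  = λ _ x → x
    ; ax2  = λ _ _ x≤y y≤x → x≤y , y≤x
    ; ax3  = λ _ _ _ x≤y y≤z → λ x → y≤z (x≤y x)
    ; ax4  = λ _ _ → [ inj₂ , inj₁ ] , [ inj₂ , inj₁ ]
    ; ax5  = λ _ _ → inj₁
    ; ax6  = λ _ _ _ x≤z y≤z → [ x≤z , y≤z ]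
    ; ax7  = λ _ ()
    ; ax8  = λ _ _ → tt
    ; ax9  = λ _ _ (_ , xp , _) x≈𝟘 → proj₁ x≈𝟘 xp
    ; ax10 = λ _ _ (p , xp , yp) → p , yp , xp
    ; axA¹ = λ _ _ → A¹-holds
    ; axA  = λ _ _ → A-holds
    }
    where
    A¹-holds : ∀ {m' i'} → A¹ m' i'
    A¹-holds x y s t (p , xp , yp) x≤s y≤t =
      (λ j → proj₁ (inS j)) , (λ j → proj₁ (inT j)) ,
      (λ j u _ → p , proj₂ (inS j) , proj₂ (inS u)) ,
      (λ j u _ → p , proj₂ (inT j) , proj₂ (inT u)) ,
      (λ j u → p , proj₂ (inS j) , proj₂ (inT u))
      where
      inS = λ j → ⨆-summand (s j) (x≤s j xp)
      inT = λ j → ⨆-summand (t j) (y≤t j yp)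

    A-holds : ∀ {n' i'} → Aₙ n' i'
    A-holds (T , bT) (V , bV) x t≰u t≤x with separate bT bV t≰u
    ... | p , tp , ¬up =
      (λ k → proj₁ (inX k)) ,
      (λ k xk≤u → ¬up (xk≤u (proj₂ (inX k)))) ,
      (λ k l → p , proj₂ (inX k) , proj₂ (inX l))
      where
      inX = λ k → ⨆-summand (x k) (t≤x k tp)

NonSingleton : {X : Set} → Pred (Pred X 0ℓ) 0ℓ
NonSingleton A = ∀ {p} → A p → ∃ λ q → q ≢ p × A q

∪-nonSingleton : {X : Set} {P Q : Pred X 0ℓ} →
                 NonSingleton P → NonSingleton Q → NonSingleton (P ∪ Q)
∪-nonSingleton nsP nsQ (inj₁ Pp) with nsP Pp
... | q , q≢p , Pq = q , q≢p , inj₁ Pq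
∪-nonSingleton nsP nsQ (inj₂ Qp) with nsQ Qp
... | q , q≢p , Qq = q , q≢p , inj₂ Qq

¬→⟶×¬ : ∀ {A B : Set} → Dec A → ¬ (A → B) → A × ¬ B
¬→⟶×¬ (yes a) ¬A→B = a , λ b → ¬A→B (λ _ → b)
¬→⟶×¬ (no ¬a) ¬A→B = ⊥-elim (¬A→B (λ a → ⊥-elim (¬a a)))

¬⊆⟶∃∁ : ∀ {n} {P Q : Pred (Fin n) 0ℓ} → Decidable P → Decidable Q →
        ¬ (P ⊆ Q) → Satisfiable (P ∩ ∁ Q)
¬⊆⟶∃∁ {n} {P} {Q} P? Q? P⊈Q
  with ¬∀⟶∃¬ n (λ p → P p → Q p) (λ p → P? p →-dec Q? p) (λ P⊆Q → P⊈Q (P⊆Q _))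
... | p , ¬Pp→Qp = p , ¬→⟶×¬ (P? p) ¬Pp→Qp

-- Decidability is part of membership so that a failed inclusion yields a witness point
-- constructively, as the axioms A need.
DecNonSingleton : Pred (Pred (Fin 3) 0ℓ) (lsuc 0ℓ)
DecNonSingleton A = Lift (lsuc 0ℓ) (Decidable A × NonSingleton A)

nsd-∅ : DecNonSingleton ∅
nsd-∅ = lift (∅? , λ ())

nsd-U : DecNonSingleton U
nsd-U = lift (U? , λ { {zero} _ → suc zero , (λ ()) , tt ; {suc _} _ → zero , (λ ()) , tt })

nsd-∪ : ∀ {P Q} → DecNonSingleton P → DecNonSingleton Q → DecNonSingleton (P ∪ Q)
nsd-∪ (lift (P? , nsP)) (lift (Q? , nsQ)) = lift (P? ∪? Q? , ∪-nonSingleton nsP nsQ)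

S : ContactStructure (lsuc 0ℓ) 0ℓ
S = setStructure DecNonSingleton nsd-∅ nsd-U nsd-∪

open ContactStructure S using (Carrier; _≤_; _+_)

another-point : (i p : Fin 3) → ∃ λ q → q ≢ p × i ≢ q
another-point zero             zero             = suc zero       , (λ ()) , (λ ())
another-point zero             (suc zero)       = suc (suc zero) , (λ ()) , (λ ())
another-point zero             (suc (suc zero)) = suc zero       , (λ ()) , (λ ())
another-point (suc zero)       zero             = suc (suc zero) , (λ ()) , (λ ())
another-point (suc zero)       (suc zero)       = zero           , (λ ()) , (λ ())
another-point (suc zero)       (suc (suc zero)) = zero           , (λ ()) , (λ ())
another-point (suc (suc zero)) zero             = suc zero       , (λ ()) , (λ ())
another-point (suc (suc zero)) (suc zero)       = zero           , (λ ()) , (λ ())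
another-point (suc (suc zero)) (suc (suc zero)) = zero           , (λ ()) , (λ ())

co-singleton : Fin 3 → Carrier
co-singleton i = ∁ ｛ i ｝ , lift ((λ p → ¬? (i ≟ p)) , λ {p} _ → another-point i p)

cover : co-singleton (# 1) ≤ co-singleton (# 2) + co-singleton (# 0)
cover {zero}           _   = inj₁ (λ ())
cover {suc zero}       1≢1 = ⊥-elim (1≢1 refl)
cover {suc (suc zero)} _   = inj₂ (λ ())

S-not-distributive : ¬ IsDCJS S
S-not-distributive dcjs
  with IsDCJS.axad dcjs (co-singleton (# 1)) (co-singleton (# 2)) (co-singleton (# 0)) cover
... | (A' , lift (_ , nsA')) , (B' , _) , A'⊆a , B'⊆b , x⊆A'∪B' , A'∪B'⊆x
  with x⊆A'∪B' {zero} (λ ())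
...   | inj₂ B'0 = B'⊆b B'0 refl
...   | inj₁ A'0 with nsA' A'0
...     | zero           , q≢0 , _   = q≢0 refl
...     | suc zero       , _   , A'1 = A'∪B'⊆x (inj₁ A'1) refl
...     | suc (suc zero) , _   , A'2 = A'⊆a A'2 refl

mainTheorem10 :
  Σ[ X ∈ Set ] Σ[ τ ∈ Topology X ] Σ[ B ∈ Pred (Pred X 0ℓ) (lsuc 0ℓ) ]
    ((∀ A → B A → RegularClosed τ A) ×
     Σ[ b∅ ∈ B ∅ ] Σ[ bU ∈ B U ] Σ[ b∪ ∈ (∀ {P Q} → B P → B Q → B (P ∪ Q)) ]
       (IsCJS (setStructure B b∅ bU b∪) × ¬ IsDCJS (setStructure B b∅ bU b∪)))
mainTheorem10 =
  Fin 3 , discrete (Fin 3) , DecNonSingleton , (λ A _ → regularClosed-discrete A) ,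
  nsd-∅ , nsd-U , nsd-∪ ,
  setStructure-isCJS DecNonSingleton nsd-∅ nsd-U nsd-∪
    (λ { (lift (P? , _)) (lift (Q? , _)) → ¬⊆⟶∃∁ P? Q? }) ,
  S-not-distributive
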